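{- Let $k \geq 3$ be an integer, let $c>0$, and let $G$ be an $n$-vertex graph of girth more than $2k$ with more than $2cn^{1+1/k}$ edges. Then there exists a bipartite subgraph $G'$ of $G$ such that $\delta(G')\ge cn^{1/k}$, $\Delta(G')\le n^{1/k}/c^{k-1}$, and $v(G')\ge c^k n$.
   Context: $\delta(G')$ and $\Delta(G')$ denote the minimum and maximum degree of $G'$, and $v(G')$ its number of vertices.
   Formalization: The constant $c$ ranges over the positive rationals. -}

module Defs where

open import Data.Nat as ℕ using (ℕ; zero; suc; _≤_; _<_; _∸_)
open import Data.Fin using (Fin; zero; suc)
open import Data.Bool using (Bool; true; false; T)
open import Data.Integer using (+_)
open import Data.Rational as ℚ using (ℚ; _/_; 1ℚ)
open import Data.List using (List; length; _∷_; [])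
open import Data.List.Relation.Unary.Unique.Propositional using (Unique)
open import Data.Product using (Σ; _×_; ∃)
open import Relation.Binary.PropositionalEquality using (_≡_; _≢_)
open import Relation.Nullary using (¬_; does)
open import Data.Fin using (_<?_)
open import Data.Bool using (_∧_)

ℕ→ℚ : ℕ → ℚ
ℕ→ℚ m = (+ m) / 1

_^ℚ_ : ℚ → ℕ → ℚ
q ^ℚ zero = 1ℚ
q ^ℚ suc m = q ℚ.* (q ^ℚ m)

count : ∀ {n} → (Fin n → Bool) → ℕ
count {zero} f = 0
count {suc n} f with f zero
... | true  = suc (count (λ i → f (suc i)))
... | false = count (λ i → f (suc i))

record Graph (n : ℕ) : Set where
  field
    adj     : Fin n → Fin n → Bool
    sym     : ∀ i j → adj i j ≡ adj j i
    irrefl  : ∀ i → adj i i ≡ false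
open Graph public

sumFin : ∀ {n} → (Fin n → ℕ) → ℕ
sumFin {zero} f = 0
sumFin {suc n} f = f zero ℕ.+ sumFin (λ i → f (suc i))

edgeCount : ∀ {n} → Graph n → ℕ
edgeCount {n} G = sumFin (λ i → count (λ j → does (i <? j) ∧ adj G i j))

IsCycle : ∀ {n} → Graph n → (m : ℕ) → (ℕ → Fin n) → Set
IsCycle G m f =
  (3 ≤ m) ×
  (∀ i j → i < m → j < m → f i ≡ f j → i ≡ j) ×
  (∀ i → suc i < m → T (adj G (f i) (f (suc i)))) ×
  T (adj G (f (m ∸ 1)) (f 0))

GirthGreaterThan : ∀ {n} → Graph n → ℕ → Set
GirthGreaterThan {n} G g = ∀ m (f : ℕ → Fin n) → m ≤ g → ¬ IsCycle G m f

record Subgraph {n} (G : Graph n) : Set where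
  field
    inV    : Fin n → Bool
    E      : Fin n → Fin n → Bool
    E-sym  : ∀ i j → E i j ≡ E j i
    E⊆adj  : ∀ i j → T (E i j) → T (adj G i j)
    E⊆V    : ∀ i j → T (E i j) → T (inV i)
open Subgraph public

vcount : ∀ {n} {G : Graph n} → Subgraph G → ℕ
vcount H = count (inV H)

degree : ∀ {n} {G : Graph n} → Subgraph G → Fin n → ℕ
degree H v = count (E H v)

Bipartite : ∀ {n} {G : Graph n} → Subgraph G → Set
Bipartite {n} H = Σ (Fin n → Bool) λ col → ∀ i j → T (E H i j) → col i ≢ col j

{-# OPTIONS --safe #-}
module Submission where

-- Let M = ⌊2c n^{1/k}⌋. Deleting vertices of degree ≤ M one at a time loses at most
-- M n < e(G) edges, so it stops at a nonempty subgraph R of minimum degree > M. A locally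
-- maximal cut of R (no vertex has more neighbours on its own side) keeps at least half of
-- every degree, giving a bipartite G′ with δ(G′) ≥ (M+1)/2 > c n^{1/k}. Since the girth
-- exceeds 2k, the non-backtracking walks of length k from a vertex v of G′, starting along
-- an edge of G′ and continuing inside R, end at distinct vertices (two of them meeting would
-- close a cycle of length ≤ 2k); hence deg v · M^{k-1} ≤ v(R) ≤ n, which bounds Δ(G′), and
-- (M+1) M^{k-1} ≤ v(R) = v(G′).

open import Defs
open import Data.Bool using (Bool; true; false; T; _∧_; not; _xor_; if_then_else_)
open import Data.Bool.Properties
  using (∧-zeroʳ; ∧-identityʳ; ∧-comm; T-∧; T?; not-involutive; xor-comm; xor-same; not-distribˡ-xor)
open import Data.Empty using (⊥; ⊥-elim)
open import Data.Fin using (Fin; zero; suc; _≟_; toℕ; remQuot; combine)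
import Data.Fin.Properties as Finₚ
open import Data.Integer as ℤ using (-[1+_])
import Data.Integer.Properties as ℤₚ
open import Data.Maybe as Maybe using (Maybe; just; nothing; fromMaybe)
open import Data.Nat as ℕ using (ℕ; zero; suc; _+_; _*_; _∸_; _^_; _≤_; _<_; z≤n; s≤s; _≤?_; _<?_)
import Data.Nat.Coprimality as Cop
open import Data.Nat.Induction using (<-rec)
open import Data.Nat.Properties hiding (_≟_)
open import Data.Nat.Tactic.RingSolver using (solve-∀)
open import Data.Product using (Σ; _×_; _,_; proj₁; proj₂; ∃; uncurry)
open import Data.Rational using (ℚ; 0ℚ; mkℚ; toℚᵘ; *<*) renaming (_<_ to _<ℚ_; _≤_ to _≤ℚ_; _*_ to _*ℚ_)
import Data.Rational.Properties as ℚₚ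
open import Data.Rational.Unnormalised using (mkℚᵘ; *≤*; *<*) renaming (_≃_ to _≃ᵘ_)
import Data.Rational.Unnormalised.Properties as ℚᵘₚ
open import Data.Sum using (_⊎_; inj₁; inj₂)
open import Data.Unit using (tt)
open import Function using (_∘_; _$_; Equivalence)
open import Relation.Binary using (tri<; tri≈; tri>)
open import Relation.Binary.PropositionalEquality hiding (sym; J)
import Relation.Binary.PropositionalEquality as ≡
open import Relation.Nullary using (¬_; Dec; yes; no; does)
open import Relation.Nullary.Decidable using (dec-true; dec-false; _×-dec_)
import Relation.Unary as U

indicator : Bool → ℕ
indicator true  = 1
indicator false = 0

indicator≤1 : ∀ b → indicator b ≤ 1
indicator≤1 true  = s≤s z≤n
indicator≤1 false = z≤n

sumFin-cong : ∀ {n} {f g : Fin n → ℕ} → (∀ i → f i ≡ g i) → sumFin f ≡ sumFin g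
sumFin-cong {zero}  f≗g = refl
sumFin-cong {suc n} f≗g = cong₂ _+_ (f≗g zero) (sumFin-cong (f≗g ∘ suc))

sumFin-+ : ∀ {n} (f g : Fin n → ℕ) → sumFin (λ i → f i + g i) ≡ sumFin f + sumFin g
sumFin-+ {zero}  f g = refl
sumFin-+ {suc n} f g = begin
  f zero + g zero + sumFin (λ i → f (suc i) + g (suc i))
    ≡⟨ cong (f zero + g zero +_) (sumFin-+ (f ∘ suc) (g ∘ suc)) ⟩
  f zero + g zero + (sumFin (f ∘ suc) + sumFin (g ∘ suc))
    ≡⟨ +-interchange (f zero) (g zero) _ _ ⟩
  f zero + sumFin (f ∘ suc) + (g zero + sumFin (g ∘ suc)) ∎
  where
  open ≡-Reasoning
  +-interchange : ∀ a b c d → a + b + (c + d) ≡ a + c + (b + d)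
  +-interchange = solve-∀

sumFin-mono : ∀ {n} {f g : Fin n → ℕ} → (∀ i → f i ≤ g i) → sumFin f ≤ sumFin g
sumFin-mono {zero}  f≤g = z≤n
sumFin-mono {suc n} f≤g = +-mono-≤ (f≤g zero) (sumFin-mono (f≤g ∘ suc))

sumFin-const : ∀ n c → sumFin {n} (λ _ → c) ≡ n * c
sumFin-const zero    c = refl
sumFin-const (suc n) c = cong (c +_) (sumFin-const n c)

sumFin-zero : ∀ {n} {f : Fin n → ℕ} → (∀ i → f i ≡ 0) → sumFin f ≡ 0
sumFin-zero {n} f≗0 = trans (sumFin-cong f≗0) (trans (sumFin-const n 0) (*-zeroʳ n))

sumFin-pos : ∀ {n} (f : Fin n → ℕ) → 0 < sumFin f → ∃ λ i → 0 < f i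
sumFin-pos {suc n} f pos with f zero in eq
... | suc _ = zero , subst (0 <_) (≡.sym eq) (s≤s z≤n)
... | zero with sumFin-pos (f ∘ suc) pos
...   | i , fi>0 = suc i , fi>0

_without_ : ∀ {n} → (Fin n → ℕ) → Fin n → Fin n → ℕ
(f without u) i = if does (i ≟ u) then 0 else f i

sumFin-without : ∀ {n} (f : Fin n → ℕ) (u : Fin n) → sumFin f ≡ f u + sumFin (f without u)
sumFin-without f zero    = refl
sumFin-without f (suc u) = begin
  f zero + sumFin (f ∘ suc)                                   ≡⟨ cong (f zero +_) (sumFin-without (f ∘ suc) u) ⟩
  f zero + (f (suc u) + sumFin ((f ∘ suc) without u))         ≡⟨ +-comm-front (f zero) (f (suc u)) _ ⟩
  f (suc u) + (f zero + sumFin ((f ∘ suc) without u))         ∎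
  where
  open ≡-Reasoning
  +-comm-front : ∀ a b c → a + (b + c) ≡ b + (a + c)
  +-comm-front = solve-∀

count≡sumFin : ∀ {n} (P : Fin n → Bool) → count P ≡ sumFin (indicator ∘ P)
count≡sumFin {zero}  P = refl
count≡sumFin {suc n} P with P zero
... | true  = cong suc (count≡sumFin (P ∘ suc))
... | false = count≡sumFin (P ∘ suc)

count-cong : ∀ {n} {P Q : Fin n → Bool} → (∀ i → P i ≡ Q i) → count P ≡ count Q
count-cong {P = P} {Q} P≗Q =
  trans (count≡sumFin P) (trans (sumFin-cong (cong indicator ∘ P≗Q)) (≡.sym (count≡sumFin Q)))

count≤n : ∀ {n} (P : Fin n → Bool) → count P ≤ n
count≤n {n} P = begin
  count P                    ≡⟨ count≡sumFin P ⟩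
  sumFin (indicator ∘ P)     ≤⟨ sumFin-mono (indicator≤1 ∘ P) ⟩
  sumFin {n} (λ _ → 1)       ≡⟨ trans (sumFin-const n 1) (*-identityʳ n) ⟩
  n                          ∎
  where open ≤-Reasoning

count-pos : ∀ {n} (P : Fin n → Bool) → 0 < count P → ∃ λ i → T (P i)
count-pos P pos with sumFin-pos (indicator ∘ P) (subst (0 <_) (count≡sumFin P) pos)
... | i , Pi>0 = i , indicator-pos (P i) Pi>0
  where
  indicator-pos : ∀ b → 0 < indicator b → T b
  indicator-pos true _ = tt

_∖_ : ∀ {n} → (Fin n → Bool) → Fin n → Fin n → Bool
(P ∖ u) i = P i ∧ not (does (i ≟ u))

∖-self : ∀ {n} (P : Fin n → Bool) u → (P ∖ u) u ≡ false
∖-self P u rewrite dec-true (u ≟ u) refl = ∧-zeroʳ (P u)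

T-∖ : ∀ {n} {P : Fin n → Bool} {u i} → T ((P ∖ u) i) → T (P i) × i ≢ u
T-∖ {P = P} {u} {i} Pi∖u with Equivalence.to T-∧ Pi∖u
... | Pi , i≢u = Pi , λ { refl → subst (T ∘ not) (dec-true (u ≟ u) refl) i≢u }

count-∖ : ∀ {n} (P : Fin n → Bool) u → count P ≡ indicator (P u) + count (P ∖ u)
count-∖ P u = begin
  count P                                                     ≡⟨ count≡sumFin P ⟩
  sumFin (indicator ∘ P)                                      ≡⟨ sumFin-without (indicator ∘ P) u ⟩
  indicator (P u) + sumFin ((indicator ∘ P) without u)        ≡⟨ cong (indicator (P u) +_) (sumFin-cong agree) ⟩
  indicator (P u) + sumFin ((indicator ∘ (P ∖ u)) without u)  ≡⟨ cong (indicator (P u) +_) remove-u ⟨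
  indicator (P u) + sumFin (indicator ∘ (P ∖ u))              ≡⟨ cong (indicator (P u) +_) (count≡sumFin (P ∖ u)) ⟨
  indicator (P u) + count (P ∖ u)                             ∎
  where
  open ≡-Reasoning
  agree : ∀ i → ((indicator ∘ P) without u) i ≡ ((indicator ∘ (P ∖ u)) without u) i
  agree i with i ≟ u
  ... | yes _ = refl
  ... | no  _ = cong indicator (≡.sym (∧-identityʳ (P i)))
  remove-u : sumFin (indicator ∘ (P ∖ u)) ≡ sumFin ((indicator ∘ (P ∖ u)) without u)
  remove-u = trans (sumFin-without (indicator ∘ (P ∖ u)) u)
                   (cong (λ b → indicator b + sumFin ((indicator ∘ (P ∖ u)) without u)) (∖-self P u))

count-∖-∈ : ∀ {n} (P : Fin n → Bool) u → T (P u) → count P ≡ suc (count (P ∖ u))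
count-∖-∈ P u Pu with P u | count-∖ P u
... | true | eq = eq

count-split : ∀ {n} (P Q : Fin n → Bool) → count (λ i → P i ∧ not (Q i)) + count (λ i → P i ∧ Q i) ≡ count P
count-split P Q = begin
  count (λ i → P i ∧ not (Q i)) + count (λ i → P i ∧ Q i)
    ≡⟨ cong₂ _+_ (count≡sumFin (λ i → P i ∧ not (Q i))) (count≡sumFin (λ i → P i ∧ Q i)) ⟩
  sumFin (λ i → indicator (P i ∧ not (Q i))) + sumFin (λ i → indicator (P i ∧ Q i))
    ≡⟨ sumFin-+ (λ i → indicator (P i ∧ not (Q i))) (λ i → indicator (P i ∧ Q i)) ⟨
  sumFin (λ i → indicator (P i ∧ not (Q i)) + indicator (P i ∧ Q i))
    ≡⟨ sumFin-cong (λ i → split (P i) (Q i)) ⟩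
  sumFin (indicator ∘ P)       ≡⟨ count≡sumFin P ⟨
  count P                      ∎
  where
  open ≡-Reasoning
  split : ∀ p q → indicator (p ∧ not q) + indicator (p ∧ q) ≡ indicator p
  split true  true  = refl
  split true  false = refl
  split false _     = refl

count-false : ∀ {n} {P : Fin n → Bool} → (∀ i → P i ≡ false) → count P ≡ 0
count-false {P = P} P≗false = trans (count≡sumFin P) (sumFin-zero (cong indicator ∘ P≗false))

rank : ∀ {n} (P : Fin n → Bool) (x : Fin n) → T (P x) → Fin (count P)
rank {suc n} P zero    Px with P zero
... | true = zero
rank {suc n} P (suc x) Px with P zero
... | true  = suc (rank (P ∘ suc) x Px)
... | false = rank (P ∘ suc) x Px

rank-injective : ∀ {n} (P : Fin n → Bool) x y (Px : T (P x)) (Py : T (P y)) →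
                 rank P x Px ≡ rank P y Py → x ≡ y
rank-injective {suc n} P zero    zero    Px Py eq = refl
rank-injective {suc n} P zero    (suc y) Px Py eq with P zero
rank-injective {suc n} P zero    (suc y) Px Py () | true
rank-injective {suc n} P (suc x) zero    Px Py eq with P zero
rank-injective {suc n} P (suc x) zero    Px Py () | true
rank-injective {suc n} P (suc x) (suc y) Px Py eq with P zero
... | true  = cong suc (rank-injective (P ∘ suc) x y Px Py (Finₚ.suc-injective eq))
... | false = cong suc (rank-injective (P ∘ suc) x y Px Py eq)

injective⇒≤count : ∀ {a n} (P : Fin n → Bool) (g : Fin a → Fin n) → (∀ x → T (P (g x))) →
                   (∀ x y → g x ≡ g y → x ≡ y) → a ≤ count P
injective⇒≤count P g P∘g g-inj = Finₚ.injective⇒≤ {f = λ x → rank P (g x) (P∘g x)}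
  (λ {x} {y} eq → g-inj x y (rank-injective P (g x) (g y) (P∘g x) (P∘g y) eq))

nth : ∀ {n} → (Fin n → Bool) → ℕ → Maybe (Fin n)
nth {zero}  P a = nothing
nth {suc n} P a with P zero | a
... | true  | zero  = just zero
... | true  | suc a = Maybe.map suc (nth (P ∘ suc) a)
... | false | a     = Maybe.map suc (nth (P ∘ suc) a)

nth-just : ∀ {n} (P : Fin n → Bool) a → a < count P → ∃ λ x → nth P a ≡ just x × T (P x)
nth-just {suc n} P a a<count with P zero in eq
nth-just {suc n} P zero    _               | true  = zero , refl , subst T (≡.sym eq) tt
nth-just {suc n} P (suc a) (s≤s a<count)   | true  with nth-just (P ∘ suc) a a<count
... | x , nth≡x , Px = suc x , cong (Maybe.map suc) nth≡x , Px
nth-just {suc n} P a       a<count         | false with nth-just (P ∘ suc) a a<count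
... | x , nth≡x , Px = suc x , cong (Maybe.map suc) nth≡x , Px

map-suc≡just : ∀ {n} (m : Maybe (Fin n)) {x} → Maybe.map suc m ≡ just x → ∃ λ y → m ≡ just y × x ≡ suc y
map-suc≡just (just y) refl = y , refl , refl

nth-injective : ∀ {n} (P : Fin n → Bool) a b {x} → nth P a ≡ just x → nth P b ≡ just x → a ≡ b
nth-injective {suc n} P a b nth-a nth-b with P zero
nth-injective {suc n} P zero    zero    nth-a nth-b | true = refl
nth-injective {suc n} P zero    (suc b) refl  nth-b | true with map-suc≡just (nth (P ∘ suc) b) nth-b
... | _ , _ , ()
nth-injective {suc n} P (suc a) zero    nth-a refl  | true with map-suc≡just (nth (P ∘ suc) a) nth-a
... | _ , _ , ()
nth-injective {suc n} P (suc a) (suc b) nth-a nth-b | true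
  with map-suc≡just (nth (P ∘ suc) a) nth-a | map-suc≡just (nth (P ∘ suc) b) nth-b
... | y , nth-a′ , refl | _ , nth-b′ , y≡ =
  cong suc (nth-injective (P ∘ suc) a b nth-a′ (trans nth-b′ (cong just (Finₚ.suc-injective (≡.sym y≡)))))
nth-injective {suc n} P a b nth-a nth-b | false
  with map-suc≡just (nth (P ∘ suc) a) nth-a | map-suc≡just (nth (P ∘ suc) b) nth-b
... | y , nth-a′ , refl | _ , nth-b′ , y≡ =
  nth-injective (P ∘ suc) a b nth-a′ (trans nth-b′ (cong just (Finₚ.suc-injective (≡.sym y≡))))

ΣΣ : ∀ {n} → (Fin n → Fin n → ℕ) → ℕ
ΣΣ F = sumFin (λ i → sumFin (F i))

-- The diagonal entry F u u is counted twice.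
cross : ∀ {n} → (Fin n → Fin n → ℕ) → Fin n → ℕ
cross F u = sumFin (F u) + sumFin (λ i → F i u)

minor : ∀ {n} → (Fin n → Fin n → ℕ) → Fin n → Fin n → Fin n → ℕ
minor F u i j = if does (i ≟ u) then 0 else (F i without u) j

ΣΣ-minor : ∀ {n} (F : Fin n → Fin n → ℕ) u → ΣΣ F + F u u ≡ cross F u + ΣΣ (minor F u)
ΣΣ-minor {n} F u = begin
  ΣΣ F + F u u                                                ≡⟨ cong (_+ F u u) (sumFin-without rows u) ⟩
  sumFin (F u) + sumFin (rows without u) + F u u              ≡⟨ cong (λ s → sumFin (F u) + s + F u u) split ⟩
  sumFin (F u) + (sumFin (col without u) + ΣΣ (minor F u)) + F u u
    ≡⟨ rearrange (sumFin (F u)) (sumFin (col without u)) (ΣΣ (minor F u)) (F u u) ⟩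
  sumFin (F u) + (F u u + sumFin (col without u)) + ΣΣ (minor F u)
    ≡⟨ cong (λ s → sumFin (F u) + s + ΣΣ (minor F u)) (sumFin-without col u) ⟨
  cross F u + ΣΣ (minor F u)                                  ∎
  where
  open ≡-Reasoning
  rows col : Fin n → ℕ
  rows i = sumFin (F i)
  col  i = F i u
  rearrange : ∀ a b c d → a + (b + c) + d ≡ a + (d + b) + c
  rearrange = solve-∀
  row-split : ∀ i → (rows without u) i ≡ (col without u) i + sumFin (minor F u i)
  row-split i with i ≟ u
  ... | yes _ = ≡.sym (sumFin-zero {n} {λ _ → 0} (λ _ → refl))
  ... | no  _ = sumFin-without (F i) u
  split : sumFin (rows without u) ≡ sumFin (col without u) + ΣΣ (minor F u)
  split = trans (sumFin-cong row-split) (sumFin-+ (col without u) (λ i → sumFin (minor F u i)))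

ΣΣ-exchange : ∀ {n} u (F G : Fin n → Fin n → ℕ) → (∀ i j → i ≢ u → j ≢ u → F i j ≡ G i j) →
              ΣΣ F + F u u + cross G u ≡ ΣΣ G + G u u + cross F u
ΣΣ-exchange u F G agree = begin
  ΣΣ F + F u u + cross G u                  ≡⟨ cong (_+ cross G u) (ΣΣ-minor F u) ⟩
  cross F u + ΣΣ (minor F u) + cross G u    ≡⟨ cong (λ s → cross F u + s + cross G u) same-minor ⟩
  cross F u + ΣΣ (minor G u) + cross G u    ≡⟨ swap-ends (cross F u) _ (cross G u) ⟩
  cross G u + ΣΣ (minor G u) + cross F u    ≡⟨ cong (_+ cross F u) (ΣΣ-minor G u) ⟨
  ΣΣ G + G u u + cross F u                  ∎
  where
  open ≡-Reasoning
  swap-ends : ∀ a b c → a + b + c ≡ c + b + a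
  swap-ends = solve-∀
  minor-agree : ∀ i j → minor F u i j ≡ minor G u i j
  minor-agree i j with i ≟ u | j ≟ u
  ... | yes _ | _     = refl
  ... | no  _ | yes _ = refl
  ... | no i≢u | no j≢u = agree i j i≢u j≢u
  same-minor : ΣΣ (minor F u) ≡ ΣΣ (minor G u)
  same-minor = sumFin-cong (λ i → sumFin-cong (minor-agree i))

upper : ∀ {n} → (Fin n → Fin n → Bool) → Fin n → Fin n → ℕ
upper E i j = indicator (does (i Finₚ.<? j) ∧ E i j)

upper-diag : ∀ {n} (E : Fin n → Fin n → Bool) u → E u u ≡ false → upper E u u ≡ 0
upper-diag E u Euu rewrite Euu = cong indicator (∧-zeroʳ (does (u Finₚ.<? u)))

cross-upper : ∀ {n} (E : Fin n → Fin n → Bool) → (∀ i j → E i j ≡ E j i) → ∀ u → E u u ≡ false →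
              cross (upper E) u ≡ count (E u)
cross-upper E E-sym u Euu = begin
  cross (upper E) u                                   ≡⟨ sumFin-+ (upper E u) (λ j → upper E j u) ⟨
  sumFin (λ j → upper E u j + upper E j u)            ≡⟨ sumFin-cong once ⟩
  sumFin (indicator ∘ E u)                            ≡⟨ count≡sumFin (E u) ⟨
  count (E u)                                         ∎
  where
  open ≡-Reasoning
  once : ∀ j → upper E u j + upper E j u ≡ indicator (E u j)
  once j with Finₚ.<-cmp u j
  ... | tri< u<j _ j≮u rewrite dec-true (u Finₚ.<? j) u<j | dec-false (j Finₚ.<? u) j≮u = +-identityʳ _
  ... | tri> u≮j _ j<u rewrite dec-false (u Finₚ.<? j) u≮j | dec-true (j Finₚ.<? u) j<u = cong indicator (E-sym j u)
  ... | tri≈ _ refl _ rewrite upper-diag E u Euu | Euu = refl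

cross-sym : ∀ {n} (B : Fin n → Fin n → Bool) → (∀ i j → B i j ≡ B j i) → ∀ u →
            cross (λ i j → indicator (B i j)) u ≡ count (B u) + count (B u)
cross-sym B B-sym u = ≡.sym (cong₂ _+_ (count≡sumFin (B u))
  (trans (count≡sumFin (B u)) (sumFin-cong (λ i → cong indicator (B-sym u i)))))

module Pruning {n} (G : Graph n) where

  induced : (Fin n → Bool) → Fin n → Fin n → Bool
  induced V i j = adj G i j ∧ (V i ∧ V j)

  edgesIn : (Fin n → Bool) → ℕ
  edgesIn V = ΣΣ (upper (induced V))

  degreeIn : (Fin n → Bool) → Fin n → ℕ
  degreeIn V u = count (induced V u)

  induced-sym : ∀ V i j → induced V i j ≡ induced V j i
  induced-sym V i j = cong₂ _∧_ (Graph.sym G i j) (∧-comm (V i) (V j))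

  induced-irrefl : ∀ V i → induced V i i ≡ false
  induced-irrefl V i rewrite irrefl G i = refl

  T-induced : ∀ V {i j} → T (induced V i j) → T (adj G i j) × T (V i) × T (V j)
  T-induced V {i} {j} t with Equivalence.to T-∧ t
  ... | i~j , Vi∧Vj = i~j , Equivalence.to T-∧ Vi∧Vj

  all : Fin n → Bool
  all _ = true

  count-all : count all ≡ n
  count-all = trans (count≡sumFin all) (trans (sumFin-const n 1) (*-identityʳ n))

  edgesIn-all : edgesIn all ≡ edgeCount G
  edgesIn-all = sumFin-cong λ i →
    trans (sumFin-cong (λ j → cong (λ b → indicator (does (i Finₚ.<? j) ∧ b)) (∧-identityʳ (adj G i j))))
          (≡.sym (count≡sumFin (λ j → does (i Finₚ.<? j) ∧ adj G i j)))

  edge⇒vertex : ∀ V → 0 < edgesIn V → ∃ λ v → T (V v)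
  edge⇒vertex V 0<edges =
    let i , 0<row = sumFin-pos (λ i → sumFin (upper (induced V) i)) 0<edges
        j , t     = count-pos (above i) (subst (0 <_) (≡.sym (count≡sumFin (above i))) 0<row)
    in  i , proj₁ (proj₂ (T-induced V (proj₂ (Equivalence.to (T-∧ {does (i Finₚ.<? j)}) t))))
    where
    above : Fin n → Fin n → Bool
    above i j = does (i Finₚ.<? j) ∧ induced V i j

  edgesIn-∖ : ∀ V u → edgesIn V ≡ edgesIn (V ∖ u) + degreeIn V u
  edgesIn-∖ V u = +-cancelʳ-≡ 0 _ _ (begin
    edgesIn V + 0                                     ≡⟨ trans (+-assoc (edgesIn V) _ _) (cong (edgesIn V +_) cross-removed) ⟨
    edgesIn V + upper I u u + cross (upper I′) u     ≡⟨ ΣΣ-exchange u (upper I) (upper I′) agree ⟩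
    edgesIn (V ∖ u) + upper I′ u u + cross (upper I) u
      ≡⟨ cong₂ _+_ (cong (edgesIn (V ∖ u) +_) (upper-diag I′ u (induced-irrefl (V ∖ u) u)))
                   (cross-upper I (induced-sym V) u (induced-irrefl V u)) ⟩
    edgesIn (V ∖ u) + 0 + degreeIn V u                ≡⟨ cong (_+ degreeIn V u) (+-identityʳ _) ⟩
    edgesIn (V ∖ u) + degreeIn V u                    ≡⟨ +-identityʳ _ ⟨
    edgesIn (V ∖ u) + degreeIn V u + 0                ∎)
    where
    open ≡-Reasoning
    I I′ : Fin n → Fin n → Bool
    I  = induced V
    I′ = induced (V ∖ u)
    cross-removed : upper I u u + cross (upper I′) u ≡ 0
    cross-removed = cong₂ _+_ (upper-diag I u (induced-irrefl V u))
      (trans (cross-upper I′ (induced-sym (V ∖ u)) u (induced-irrefl (V ∖ u) u))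
             (count-false (λ j → trans (cong (λ b → adj G u j ∧ (b ∧ (V ∖ u) j)) (∖-self V u))
                                       (∧-zeroʳ (adj G u j)))))
    agree : ∀ i j → i ≢ u → j ≢ u → upper I i j ≡ upper I′ i j
    agree i j i≢u j≢u rewrite dec-false (i ≟ u) i≢u | dec-false (j ≟ u) j≢u
                            | ∧-identityʳ (V i) | ∧-identityʳ (V j) = refl

  prune : (M fuel : ℕ) (V : Fin n → Bool) → count V ≤ fuel →
          Σ (Fin n → Bool) λ R → (∀ u → T (R u) → M < degreeIn R u) × edgesIn V ≤ edgesIn R + M * count V
  prune M fuel V V≤fuel with Finₚ.any? (λ u → T? (V u) ×-dec (degreeIn V u ≤? M))
  ... | no ¬low = V , (λ u Vu → ≰⇒> (λ deg≤M → ¬low (u , Vu , deg≤M))) , m≤m+n _ _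
  ... | yes (u , Vu , deg≤M) with fuel | count-∖-∈ V u Vu
  ...   | zero   | V≡ = ⊥-elim (n≮0 (subst (_≤ 0) V≡ V≤fuel))
  ...   | suc fuel′ | V≡ with prune M fuel′ (V ∖ u) (≤-pred (subst (_≤ suc fuel′) V≡ V≤fuel))
  ...     | R , R-deg , bound = R , R-deg , (begin
    edgesIn V                                     ≡⟨ edgesIn-∖ V u ⟩
    edgesIn (V ∖ u) + degreeIn V u                ≤⟨ +-mono-≤ bound deg≤M ⟩
    edgesIn R + M * count (V ∖ u) + M             ≡⟨ +-assoc (edgesIn R) _ M ⟩
    edgesIn R + (M * count (V ∖ u) + M)           ≡⟨ cong (edgesIn R +_) (+-comm _ M) ⟩
    edgesIn R + (M + M * count (V ∖ u))           ≡⟨ cong (edgesIn R +_) (*-suc M _) ⟨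
    edgesIn R + M * suc (count (V ∖ u))           ≡⟨ cong (λ c → edgesIn R + M * c) V≡ ⟨
    edgesIn R + M * count V                       ∎)
    where open ≤-Reasoning

  dense⇒core : ∀ M → M * n < edgeCount G →
               Σ (Fin n → Bool) λ R → (∀ u → T (R u) → M < degreeIn R u) × ∃ λ v → T (R v)
  dense⇒core M M*n<e =
    let R , R-deg , e≤ = prune M n all (≤-reflexive count-all)
        0<edges : 0 < edgesIn R
        0<edges = ≰⇒> λ edges≤0 → <⇒≱ M*n<e (begin
          edgeCount G                   ≡⟨ edgesIn-all ⟨
          edgesIn all                   ≤⟨ e≤ ⟩
          edgesIn R + M * count all     ≤⟨ +-mono-≤ edges≤0 (≤-reflexive (cong (M *_) count-all)) ⟩
          M * n                         ∎)
    in  R , R-deg , edge⇒vertex R 0<edges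
    where open ≤-Reasoning

module LocalMaxCut {n} (E : Fin n → Fin n → Bool) (E-sym : ∀ i j → E i j ≡ E j i)
                   (E-irrefl : ∀ i → E i i ≡ false) where

  monochromatic bichromatic : (Fin n → Bool) → Fin n → Fin n → Bool
  monochromatic col i j = E i j ∧ not (col i xor col j)
  bichromatic   col i j = E i j ∧ (col i xor col j)

  bichromatic-sym : ∀ col i j → bichromatic col i j ≡ bichromatic col j i
  bichromatic-sym col i j = cong₂ _∧_ (E-sym i j) (xor-comm (col i) (col j))

  monochromatic-sym : ∀ col i j → monochromatic col i j ≡ monochromatic col j i
  monochromatic-sym col i j = cong₂ _∧_ (E-sym i j) (cong not (xor-comm (col i) (col j)))

  -- Twice the number of monochromatic edges.
  defect : (Fin n → Bool) → ℕ
  defect col = ΣΣ (λ i j → indicator (monochromatic col i j))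

  recolour : (Fin n → Bool) → Fin n → Fin n → Bool
  recolour col u i = if does (i ≟ u) then not (col i) else col i

  recolour-self : ∀ col u → recolour col u u ≡ not (col u)
  recolour-self col u rewrite dec-true (u ≟ u) refl = refl

  recolour-row : ∀ col u j → monochromatic (recolour col u) u j ≡ bichromatic col u j
  recolour-row col u j with j ≟ u
  ... | yes refl rewrite E-irrefl u = refl
  ... | no j≢u = cong (E u j ∧_) (begin
    not (recolour col u u xor col j)   ≡⟨ cong (λ b → not (b xor col j)) (recolour-self col u) ⟩
    not (not (col u) xor col j)        ≡⟨ cong not (not-distribˡ-xor (col u) (col j)) ⟨
    not (not (col u xor col j))        ≡⟨ not-involutive _ ⟩
    col u xor col j                    ∎)
    where open ≡-Reasoning

  recolour-defect : ∀ col u →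
    defect col + (count (bichromatic col u) + count (bichromatic col u)) ≡
    defect (recolour col u) + (count (monochromatic col u) + count (monochromatic col u))
  recolour-defect col u = begin
    defect col + (count (bichromatic col u) + count (bichromatic col u))
      ≡⟨ cong (defect col +_) (trans (cross-sym _ (monochromatic-sym col′) u) (cong₂ _+_ row row)) ⟨
    defect col + cross M′ u                  ≡⟨ cong (_+ cross M′ u) (trans (cong (defect col +_) (diagonal col)) (+-identityʳ _)) ⟨
    defect col + M u u + cross M′ u          ≡⟨ ΣΣ-exchange u M M′ agree ⟩
    defect col′ + M′ u u + cross M u
      ≡⟨ cong₂ _+_ (trans (cong (defect col′ +_) (diagonal col′)) (+-identityʳ _)) (cross-sym _ (monochromatic-sym col) u) ⟩
    defect col′ + (count (monochromatic col u) + count (monochromatic col u)) ∎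
    where
    open ≡-Reasoning
    col′ : Fin n → Bool
    col′ = recolour col u
    M M′ : Fin n → Fin n → ℕ
    M  i j = indicator (monochromatic col i j)
    M′ i j = indicator (monochromatic col′ i j)
    diagonal : ∀ c → indicator (monochromatic c u u) ≡ 0
    diagonal c rewrite E-irrefl u = refl
    row : count (monochromatic col′ u) ≡ count (bichromatic col u)
    row = count-cong (recolour-row col u)
    agree : ∀ i j → i ≢ u → j ≢ u → M i j ≡ M′ i j
    agree i j i≢u j≢u rewrite dec-false (i ≟ u) i≢u | dec-false (j ≟ u) j≢u = refl

  localMaxCut : (fuel : ℕ) (col : Fin n → Bool) → defect col < fuel →
                Σ (Fin n → Bool) λ col′ → ∀ u → count (monochromatic col′ u) ≤ count (bichromatic col′ u)
  localMaxCut fuel col defect<fuel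
    with Finₚ.any? (λ u → count (bichromatic col u) <? count (monochromatic col u))
  ... | no ¬improvable = col , λ u → ≮⇒≥ (λ bi<mono → ¬improvable (u , bi<mono))
  localMaxCut (suc fuel) col (s≤s defect≤fuel) | yes (u , bi<mono) =
    localMaxCut fuel (recolour col u) (<-≤-trans decreases defect≤fuel)
    where
    mono : ℕ
    mono = count (monochromatic col u)
    decreases : defect (recolour col u) < defect col
    decreases = +-cancelʳ-< _ _ _ (subst (_< defect col + (mono + mono)) (recolour-defect col u)
                                         (+-monoʳ-< (defect col) (+-mono-< bi<mono bi<mono)))

  monochromatic+bichromatic : ∀ col u → count (monochromatic col u) + count (bichromatic col u) ≡ count (E u)
  monochromatic+bichromatic col u = count-split (E u) (λ j → col u xor col j)

minimal-witness : {P : ℕ → Set} → U.Decidable P → ∀ b → P b →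
                  ∃ λ m → m ≤ b × P m × (∀ {a} → a < m → ¬ P a)
minimal-witness {P} P? = <-rec (λ b → P b → ∃ λ m → m ≤ b × P m × (∀ {a} → a < m → ¬ P a)) step
  where
  step : ∀ b → (∀ {a} → a < b → P a → ∃ λ m → m ≤ a × P m × (∀ {c} → c < m → ¬ P c)) →
         P b → ∃ λ m → m ≤ b × P m × (∀ {a} → a < m → ¬ P a)
  step b smaller Pb with anyUpTo? P? b
  ... | no none = b , ≤-refl , Pb , λ a<b Pa → none (_ , a<b , Pa)
  ... | yes (a , a<b , Pa) with smaller a<b Pa
  ...   | m , m≤a , Pm , m-min = m , ≤-trans m≤a (<⇒≤ a<b) , Pm , m-min

module ClosedWalk {n} (G : Graph n) (w : ℕ → Fin n) (L : ℕ)
                  (steps : ∀ i → i < L → T (adj G (w i) (w (suc i))))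
                  (nonBacktracking : ∀ i → 2 + i ≤ L → w i ≢ w (2 + i)) where

  Revisits : ℕ → Set
  Revisits b = ∃ λ a → a < b × w a ≡ w b

  revisits? : U.Decidable Revisits
  revisits? b = anyUpTo? (λ a → w a Finₚ.≟ w b) b

  -- The walk between the first revisit w b and the earlier visit w a of the same vertex is a cycle.
  closed⇒cycle : 0 < L → w 0 ≡ w L → ∃ λ m → ∃ λ f → m ≤ L × IsCycle G m f
  closed⇒cycle 0<L closed with minimal-witness revisits? L (0 , 0<L , closed)
  ... | b , b≤L , (a , a<b , wa≡wb) , first with m≤n⇒∃[o]m+o≡n a<b
  ...   | d , refl = suc d , f , ≤-trans (m≤n+m (suc d) a) (≤-trans (≤-reflexive (+-suc a d)) b≤L) ,
                     length≥3 , f-injective , f-steps , f-closes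
    where
    f : ℕ → Fin n
    f i = w (a + i)
    b≡ : a + suc d ≡ suc (a + d)
    b≡ = +-suc a d
    step : ∀ i → i ≤ d → T (adj G (f i) (w (suc (a + i))))
    step i i≤d = steps (a + i) (≤-trans (s≤s (+-monoʳ-≤ a i≤d)) b≤L)
    f-steps : ∀ i → suc i < suc d → T (adj G (f i) (f (suc i)))
    f-steps i (s≤s i<d) = subst (λ v → T (adj G (f i) v)) (cong w (≡.sym (+-suc a i))) (step i (<⇒≤ i<d))
    last≡first : w (suc (a + d)) ≡ f 0
    last≡first = trans (≡.sym wa≡wb) (cong w (≡.sym (+-identityʳ a)))
    f-closes : T (adj G (f (suc d ∸ 1)) (f 0))
    f-closes = subst (λ v → T (adj G (f d) v)) last≡first (step d ≤-refl)
    inside : ∀ i → i < suc d → a + i < suc a + d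
    inside i i<m = ≤-trans (+-monoʳ-< a i<m) (≤-reflexive b≡)
    f-injective : ∀ i j → i < suc d → j < suc d → f i ≡ f j → i ≡ j
    f-injective i j i<m j<m fi≡fj with <-cmp i j
    ... | tri≈ _ i≡j _ = i≡j
    ... | tri< i<j _ _ = ⊥-elim (first (inside j j<m) (a + i , +-monoʳ-< a i<j , fi≡fj))
    ... | tri> _ _ j<i = ⊥-elim (first (inside i i<m) (a + j , +-monoʳ-< a j<i , ≡.sym fi≡fj))
    d≢0 : d ≢ 0
    d≢0 d≡0 = subst T (irrefl G (f 0)) (subst (λ i → T (adj G (f i) (f 0))) d≡0 f-closes)
    d≢1 : d ≢ 1
    d≢1 d≡1 = nonBacktracking a (subst (_≤ L) b≡2+a b≤L) (trans wa≡wb (cong w b≡2+a))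
      where
      b≡2+a : suc a + d ≡ 2 + a
      b≡2+a = trans (cong (suc a +_) d≡1) (cong suc (+-comm a 1))
    length≥3 : 3 ≤ suc d
    length≥3 = s≤s (≢0,1⇒2≤ d d≢0 d≢1)
      where
      ≢0,1⇒2≤ : ∀ e → e ≢ 0 → e ≢ 1 → 2 ≤ e
      ≢0,1⇒2≤ zero          e≢0 _   = ⊥-elim (e≢0 refl)
      ≢0,1⇒2≤ (suc zero)    _   e≢1 = ⊥-elim (e≢1 refl)
      ≢0,1⇒2≤ (suc (suc e)) _   _   = s≤s (s≤s z≤n)

module MooreBound {n} (G : Graph n) (k : ℕ) (girth : GirthGreaterThan G (2 * k))
  (E : Fin n → Fin n → Bool) (V : Fin n → Bool) (m : ℕ)
  (E⊆adj : ∀ x y → T (E x y) → T (adj G x y)) (E⊆V : ∀ x y → T (E x y) → T (V y))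
  (minDegree : ∀ x → T (V x) → suc m ≤ count (E x))
  (v : Fin n) (F : Fin n → Bool)
  (F⊆adj : ∀ y → T (F y) → T (adj G v y)) (F⊆V : ∀ y → T (F y) → T (V y)) where

  -- The default v in start and next is never reached on the walks considered.
  start : ℕ → Fin n
  start a = fromMaybe v (nth F a)

  next : Fin n → Fin n → ℕ → Fin n
  next p c a = fromMaybe v (nth (E c ∖ p) a)

  start-ok : ∀ a → a < count F → T (F (start a))
  start-ok a a<count with nth-just F a a<count
  ... | x , nth≡x , Fx rewrite nth≡x = Fx

  start-injective : ∀ a b → a < count F → b < count F → start a ≡ start b → a ≡ b
  start-injective a b a<count b<count eq with nth-just F a a<count | nth-just F b b<count
  ... | x , nth-a , _ | y , nth-b , _ rewrite nth-a | nth-b = nth-injective F a b nth-a (trans nth-b (cong just (≡.sym eq)))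

  m≤count-∖ : ∀ p c → T (V c) → m ≤ count (E c ∖ p)
  m≤count-∖ p c Vc = ≤-pred (begin
    suc m                                  ≤⟨ minDegree c Vc ⟩
    count (E c)                            ≡⟨ count-∖ (E c) p ⟩
    indicator (E c p) + count (E c ∖ p)    ≤⟨ +-monoˡ-≤ _ (indicator≤1 (E c p)) ⟩
    suc (count (E c ∖ p))                  ∎)
    where open ≤-Reasoning

  next-ok : ∀ p c a → T (V c) → a < m → T (E c (next p c a)) × next p c a ≢ p
  next-ok p c a Vc a<m with nth-just (E c ∖ p) a (<-≤-trans a<m (m≤count-∖ p c Vc))
  ... | x , nth≡x , x∈ rewrite nth≡x = T-∖ {P = E c} x∈

  next-injective : ∀ p c a b → T (V c) → a < m → b < m → next p c a ≡ next p c b → a ≡ b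
  next-injective p c a b Vc a<m b<m eq
    with nth-just (E c ∖ p) a (<-≤-trans a<m (m≤count-∖ p c Vc))
       | nth-just (E c ∖ p) b (<-≤-trans b<m (m≤count-∖ p c Vc))
  ... | x , nth-a , _ | y , nth-b , _ rewrite nth-a | nth-b =
    nth-injective (E c ∖ p) a b nth-a (trans nth-b (cong just (≡.sym eq)))

  walk : (ℕ → ℕ) → ℕ → Fin n
  walk s zero          = v
  walk s (suc zero)    = start (s 0)
  walk s (suc (suc i)) = next (walk s i) (walk s (suc i)) (s (suc i))

  Admissible : ℕ → (ℕ → ℕ) → Set
  Admissible J s = s 0 < count F × (∀ i → 0 < i → i < J → s i < m)

  walk-in-V : ∀ {J s} → Admissible J s → ∀ i → 0 < i → i ≤ J → T (V (walk s i))
  walk-in-V ok (suc zero)    _ _ = F⊆V _ (start-ok _ (proj₁ ok))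
  walk-in-V ok (suc (suc i)) _ i<J =
    E⊆V _ _ (proj₁ (next-ok _ _ _ (walk-in-V ok (suc i) (s≤s z≤n) (<⇒≤ i<J))
                                  (proj₂ ok (suc i) (s≤s z≤n) i<J)))

  walk-next : ∀ {J s} → Admissible J s → ∀ i → 2 + i ≤ J →
              T (E (walk s (suc i)) (walk s (2 + i))) × walk s (2 + i) ≢ walk s i
  walk-next ok i i<J =
    next-ok _ _ _ (walk-in-V ok (suc i) (s≤s z≤n) (<⇒≤ i<J)) (proj₂ ok (suc i) (s≤s z≤n) i<J)

  walk-steps : ∀ {J s} → Admissible J s → ∀ i → i < J → T (adj G (walk s i) (walk s (suc i)))
  walk-steps ok zero    _   = F⊆adj _ (start-ok _ (proj₁ ok))
  walk-steps ok (suc i) i<J = E⊆adj _ _ (proj₁ (walk-next ok i i<J))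

  walk-cong : ∀ J s s′ → (∀ i → i < J → s i ≡ s′ i) → ∀ i → i ≤ J → walk s i ≡ walk s′ i
  walk-cong J s s′ s≗s′ zero          _   = refl
  walk-cong J s s′ s≗s′ (suc zero)    i≤J = cong start (s≗s′ 0 i≤J)
  walk-cong J s s′ s≗s′ (suc (suc i)) i≤J =
    cong₂ _$_ (cong₂ next (walk-cong J s s′ s≗s′ i (≤-trans (n≤1+n i) (<⇒≤ i≤J)))
                          (walk-cong J s s′ s≗s′ (suc i) (<⇒≤ i≤J)))
              (s≗s′ (suc i) i≤J)

  -- Two walks of length J that end together but not one step earlier glue, the second one
  -- reversed, into a closed non-backtracking walk of length 2J.
  module Glued (j : ℕ) {s s′ : ℕ → ℕ} (ok : Admissible (2 + j) s) (ok′ : Admissible (2 + j) s′)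
               (same-end : walk s (2 + j) ≡ walk s′ (2 + j)) (diverge : walk s (suc j) ≢ walk s′ (suc j)) where

    J L : ℕ
    J = 2 + j
    L = J + J

    w : ℕ → Fin n
    w i = if does (i ≤? J) then walk s i else walk s′ (L ∸ i)

    w-left : ∀ {i} → i ≤ J → w i ≡ walk s i
    w-left {i} i≤J rewrite dec-true (i ≤? J) i≤J = refl

    w-right : ∀ {i} → J ≤ i → w i ≡ walk s′ (L ∸ i)
    w-right {i} J≤i with i ≤? J
    ... | no i≰J rewrite dec-false (i ≤? J) i≰J = refl
    ... | yes i≤J with ≤-antisym i≤J J≤i
    ...   | refl = trans (w-left ≤-refl) (trans same-end (cong (walk s′) (≡.sym (m+n∸n≡m J J))))

    L∸≤J : ∀ {i} → J ≤ i → L ∸ i ≤ J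
    L∸≤J {i} J≤i = ≤-trans (∸-monoʳ-≤ L J≤i) (≤-reflexive (m+n∸n≡m J J))

    w-steps : ∀ i → i < L → T (adj G (w i) (w (suc i)))
    w-steps i i<L with suc i ≤? J
    ... | yes i<J = subst₂ (λ x y → T (adj G x y)) (≡.sym (w-left (<⇒≤ i<J))) (≡.sym (w-left i<J))
                           (walk-steps ok i i<J)
    ... | no i≮J = subst₂ (λ x y → T (adj G x y)) (≡.sym w-i) (≡.sym (w-right (≤-trans J≤i (n≤1+n i))))
                     (subst T (Graph.sym G _ _) (walk-steps ok′ (L ∸ suc i) r<J))
      where
      J≤i : J ≤ i
      J≤i = ≤-pred (≰⇒> i≮J)
      L∸i≡ : L ∸ i ≡ suc (L ∸ suc i)
      L∸i≡ = +-∸-assoc 1 i<L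
      w-i : w i ≡ walk s′ (suc (L ∸ suc i))
      w-i = trans (w-right J≤i) (cong (walk s′) L∸i≡)
      r<J : L ∸ suc i < J
      r<J = subst (_≤ J) L∸i≡ (L∸≤J J≤i)

    w-nonBacktracking : ∀ i → 2 + i ≤ L → w i ≢ w (2 + i)
    w-nonBacktracking i 2+i≤L with <-cmp i (suc j)
    ... | tri< i<1+j _ _ rewrite w-left (≤-trans (n≤1+n i) (≤-trans (n≤1+n (suc i)) (s≤s i<1+j)))
                               | w-left (s≤s i<1+j) = ≢-sym (proj₂ (walk-next ok i (s≤s i<1+j)))
    ... | tri≈ _ refl _ rewrite w-left (n≤1+n (suc j)) | w-right (n≤1+n J) =
      λ eq → diverge (trans eq at-junction)
      where
      at-junction : walk s′ (L ∸ suc J) ≡ walk s′ (suc j)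
      at-junction = cong (walk s′)
        (suc-injective (trans (≡.sym (+-∸-assoc 1 (m<m+n J (s≤s z≤n)))) (m+n∸n≡m J J)))
    ... | tri> _ _ 1+j<i = λ eq → proj₂ (walk-next ok′ r 2+r≤J) (trans (≡.sym w-i) (trans eq w-2+i))
      where
      r : ℕ
      r = L ∸ (2 + i)
      L∸i≡ : L ∸ i ≡ 2 + r
      L∸i≡ = trans (+-∸-assoc 1 (≤-trans (n≤1+n (suc i)) 2+i≤L)) (cong suc (+-∸-assoc 1 2+i≤L))
      w-i : w i ≡ walk s′ (2 + r)
      w-i = trans (w-right 1+j<i) (cong (walk s′) L∸i≡)
      w-2+i : w (2 + i) ≡ walk s′ r
      w-2+i = w-right (≤-trans 1+j<i (≤-trans (n≤1+n i) (n≤1+n (suc i))))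
      2+r≤J : 2 + r ≤ J
      2+r≤J = subst (_≤ J) L∸i≡ (L∸≤J 1+j<i)

    w-closed : w 0 ≡ w L
    w-closed = ≡.sym (trans (w-right (m≤m+n J J)) (cong (walk s′) (n∸n≡0 L)))

    girth-violated : J ≤ k → ⊥
    girth-violated J≤k with ClosedWalk.closed⇒cycle G w L w-steps w-nonBacktracking (s≤s z≤n) w-closed
    ... | len , f , len≤L , cycle = girth len f (≤-trans len≤L L≤2k) cycle
      where
      L≤2k : L ≤ 2 * k
      L≤2k = +-mono-≤ J≤k (≤-trans J≤k (≤-reflexive (≡.sym (+-identityʳ k))))

  Admissible-≤ : ∀ {J J′ s} → J′ ≤ J → Admissible J s → Admissible J′ s
  Admissible-≤ J′≤J (s0<count , bounded) = s0<count , λ i 0<i i<J′ → bounded i 0<i (<-≤-trans i<J′ J′≤J)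

  walk-injective-step : ∀ j {s s′} → Admissible (2 + j) s → Admissible (2 + j) s′ → 2 + j ≤ k →
    (walk s (suc j) ≡ walk s′ (suc j) → ∀ i → i < suc j → s i ≡ s′ i) →
    walk s (2 + j) ≡ walk s′ (2 + j) → ∀ i → i < 2 + j → s i ≡ s′ i
  walk-injective-step j {s} {s′} ok ok′ J≤k shorter same-end with walk s (suc j) Finₚ.≟ walk s′ (suc j)
  ... | no diverge = ⊥-elim (Glued.girth-violated j ok ok′ same-end diverge J≤k)
  ... | yes agree  = λ i i<J → prefix-or-last (m≤n⇒m<n∨m≡n (≤-pred i<J))
    where
    earlier : ∀ i → i < suc j → s i ≡ s′ i
    earlier = shorter agree
    same-next : next (walk s j) (walk s (suc j)) (s (suc j)) ≡ next (walk s j) (walk s (suc j)) (s′ (suc j))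
    same-next = trans same-end (cong₂ (λ p c → next p c (s′ (suc j)))
                                      (≡.sym (walk-cong (suc j) s s′ earlier j (n≤1+n j))) (≡.sym agree))
    last : s (suc j) ≡ s′ (suc j)
    last = next-injective _ _ _ _ (walk-in-V ok (suc j) (s≤s z≤n) (n≤1+n _))
             (proj₂ ok (suc j) (s≤s z≤n) ≤-refl) (proj₂ ok′ (suc j) (s≤s z≤n) ≤-refl) same-next
    prefix-or-last : ∀ {i} → i < suc j ⊎ i ≡ suc j → s i ≡ s′ i
    prefix-or-last (inj₁ i<1+j) = earlier _ i<1+j
    prefix-or-last (inj₂ refl)  = last

  walk-injective : ∀ J → 0 < J → J ≤ k → ∀ {s s′} → Admissible J s → Admissible J s′ →
                   walk s J ≡ walk s′ J → ∀ i → i < J → s i ≡ s′ i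
  walk-injective (suc zero)    _ _ ok ok′ same-end zero    _ = start-injective _ _ (proj₁ ok) (proj₁ ok′) same-end
  walk-injective (suc zero)    _ _ ok ok′ same-end (suc i) (s≤s ())
  walk-injective (suc (suc j)) _ J≤k ok ok′ = walk-injective-step j ok ok′ J≤k
    (walk-injective (suc j) (s≤s z≤n) (≤-trans (n≤1+n _) J≤k)
                    (Admissible-≤ (n≤1+n _) ok) (Admissible-≤ (n≤1+n _) ok′))

  -- Admissible choice sequences of length j + 1, coded by Fin (#sequences j).
  #sequences : ℕ → ℕ
  #sequences zero    = count F
  #sequences (suc j) = #sequences j * m

  split : ∀ j → Fin (#sequences (suc j)) → Fin (#sequences j) × Fin m
  split j = remQuot {#sequences j} m

  decode : ∀ j → Fin (#sequences j) → ℕ → ℕ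
  decode zero    x i = toℕ x
  decode (suc j) x i =
    if does (i ℕ.≟ suc j) then toℕ (proj₂ (split j x)) else decode j (proj₁ (split j x)) i

  decode-admissible : ∀ j x → Admissible (suc j) (decode j x)
  decode-admissible zero    x = Finₚ.toℕ<n x , λ { zero () _ ; (suc i) _ (s≤s ()) }
  decode-admissible (suc j) x = proj₁ (decode-admissible j (proj₁ (split j x))) , bounded
    where
    bounded : ∀ i → 0 < i → i < 2 + j → decode (suc j) x i < m
    bounded i 0<i i<2+j with m≤n⇒m<n∨m≡n (≤-pred i<2+j)
    ... | inj₂ refl rewrite dec-true (suc j ℕ.≟ suc j) refl = Finₚ.toℕ<n _
    ... | inj₁ i<1+j rewrite dec-false (i ℕ.≟ suc j) (<⇒≢ i<1+j) =
      proj₂ (decode-admissible j (proj₁ (split j x))) i 0<i i<1+j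

  decode-injective : ∀ j x x′ → (∀ i → i < suc j → decode j x i ≡ decode j x′ i) → x ≡ x′
  decode-injective zero    x x′ agree = Finₚ.toℕ-injective (agree 0 (s≤s z≤n))
  decode-injective (suc j) x x′ agree = begin
    x                                 ≡⟨ Finₚ.combine-remQuot {#sequences j} m x ⟨
    uncurry combine (split j x)     ≡⟨ cong (uncurry combine) (cong₂ _,_ same-quot same-rem) ⟩
    uncurry combine (split j x′)    ≡⟨ Finₚ.combine-remQuot {#sequences j} m x′ ⟩
    x′                                ∎
    where
    open ≡-Reasoning
    same-quot : proj₁ (split j x) ≡ proj₁ (split j x′)
    same-quot = decode-injective j _ _ λ i i<1+j →
      subst₂ _≡_ (drop x i<1+j) (drop x′ i<1+j) (agree i (≤-trans i<1+j (n≤1+n _)))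
      where
      drop : ∀ y {i} → i < suc j → decode (suc j) y i ≡ decode j (proj₁ (split j y)) i
      drop y {i} i<1+j rewrite dec-false (i ℕ.≟ suc j) (<⇒≢ i<1+j) = refl
    same-rem : proj₂ (split j x) ≡ proj₂ (split j x′)
    same-rem = Finₚ.toℕ-injective (subst₂ _≡_ (last x) (last x′) (agree (suc j) ≤-refl))
      where
      last : ∀ y → decode (suc j) y (suc j) ≡ toℕ (proj₂ (split j y))
      last y rewrite dec-true (suc j ℕ.≟ suc j) refl = refl

  #sequences≡ : ∀ j → #sequences j ≡ count F * m ^ j
  #sequences≡ zero    = ≡.sym (*-identityʳ _)
  #sequences≡ (suc j) = begin
    #sequences j * m            ≡⟨ cong (_* m) (#sequences≡ j) ⟩
    count F * m ^ j * m         ≡⟨ *-assoc (count F) (m ^ j) m ⟩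
    count F * (m ^ j * m)       ≡⟨ cong (count F *_) (*-comm (m ^ j) m) ⟩
    count F * m ^ suc j         ∎
    where open ≡-Reasoning

  moore-bound : 1 ≤ k → count F * m ^ (k ∸ 1) ≤ count V
  moore-bound 1≤k = subst (_≤ count V) (#sequences≡ (k ∸ 1))
                          (injective⇒≤count V endpoint endpoint-in-V endpoint-injective)
    where
    j : ℕ
    j = k ∸ 1
    1+j≡k : suc j ≡ k
    1+j≡k = m+[n∸m]≡n 1≤k
    endpoint : Fin (#sequences j) → Fin n
    endpoint x = walk (decode j x) (suc j)
    endpoint-in-V : ∀ x → T (V (endpoint x))
    endpoint-in-V x = walk-in-V (decode-admissible j x) (suc j) (s≤s z≤n) ≤-refl
    endpoint-injective : ∀ x x′ → endpoint x ≡ endpoint x′ → x ≡ x′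
    endpoint-injective x x′ eq = decode-injective j x x′
      (walk-injective (suc j) (s≤s z≤n) (≤-reflexive 1+j≡k) (decode-admissible j x) (decode-admissible j x′) eq)

-- q = N / D, witnessed through the unnormalised representation of q.
IsRatio : ℚ → ℕ → ℕ → Set
IsRatio q N D = ∃ λ d → D ≡ suc d × toℚᵘ q ≃ᵘ mkℚᵘ (ℤ.+ N) d

ratio-ℕ : ∀ m → IsRatio (ℕ→ℚ m) m 1
ratio-ℕ m = 0 , refl , ℚᵘₚ.≃-reflexive (cong toℚᵘ (ℚₚ.normalize-coprime (Cop.sym (Cop.1-coprimeTo m))))

ratio-positive : ∀ c → 0ℚ <ℚ c → ∃ λ a → ∃ λ d → IsRatio c a (suc d)
ratio-positive (mkℚ (ℤ.+ a)  d _) _         = a , d , d , refl , ℚᵘₚ.≃-refl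
ratio-positive (mkℚ -[1+ _ ] d _) (*<* ())

ratio-* : ∀ {p q N N′ D D′} → IsRatio p N D → IsRatio q N′ D′ → IsRatio (p *ℚ q) (N * N′) (D * D′)
ratio-* {p} {q} {N} {N′} (_ , refl , p≃) (_ , refl , q≃) = _ , refl ,
  ℚᵘₚ.≃-trans (ℚₚ.toℚᵘ-homo-* p q)
    (ℚᵘₚ.≃-trans (ℚᵘₚ.*-cong p≃ q≃) (ℚᵘₚ.≃-reflexive (cong (λ z → mkℚᵘ z _) (≡.sym (ℤₚ.pos-* N N′)))))

ratio-^ : ∀ {q N D} → IsRatio q N D → ∀ k → IsRatio (q ^ℚ k) (N ^ k) (D ^ k)
ratio-^ q≐ zero    = ratio-ℕ 1
ratio-^ q≐ (suc k) = ratio-* q≐ (ratio-^ q≐ k)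

ratio-ℕ^ : ∀ m k → IsRatio (ℕ→ℚ m ^ℚ k) (m ^ k) 1
ratio-ℕ^ m k = subst (IsRatio (ℕ→ℚ m ^ℚ k) (m ^ k)) (^-zeroˡ k) (ratio-^ (ratio-ℕ m) k)

ratio-≤ : ∀ {p q N N′ D D′} → IsRatio p N D → IsRatio q N′ D′ → N * D′ ≤ N′ * D → p ≤ℚ q
ratio-≤ {p} {q} {N} {N′} (d , refl , p≃) (d′ , refl , q≃) cross≤ =
  ℚₚ.toℚᵘ-cancel-≤ (ℚᵘₚ.≤-respʳ-≃ (ℚᵘₚ.≃-sym q≃) (ℚᵘₚ.≤-respˡ-≃ (ℚᵘₚ.≃-sym p≃) (*≤* (subst₂ ℤ._≤_
    (ℤₚ.pos-* N (suc d′)) (ℤₚ.pos-* N′ (suc d)) (ℤ.+≤+ cross≤)))))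

ratio-< : ∀ {p q N N′ D D′} → IsRatio p N D → IsRatio q N′ D′ → p <ℚ q → N * D′ < N′ * D
ratio-< {p} {q} {N} {N′} (d , refl , p≃) (d′ , refl , q≃) p<q
  with ℚᵘₚ.<-respʳ-≃ q≃ (ℚᵘₚ.<-respˡ-≃ p≃ (ℚₚ.toℚᵘ-mono-< p<q))
... | *<* cross< =
  ℤₚ.drop‿+<+ (subst₂ ℤ._<_ (≡.sym (ℤₚ.pos-* N (suc d′))) (≡.sym (ℤₚ.pos-* N′ (suc d))) cross<)

^-distribʳ-* : ∀ m n k → (m * n) ^ k ≡ m ^ k * n ^ k
^-distribʳ-* m n zero    = refl
^-distribʳ-* m n (suc k) rewrite ^-distribʳ-* m n k = interchange m n (m ^ k) (n ^ k)
  where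
  interchange : ∀ a b c d → a * b * (c * d) ≡ a * c * (b * d)
  interchange = solve-∀

crossing-point : {P : ℕ → Set} → U.Decidable P → P 0 → ∀ N → ¬ P N → ∃ λ M → P M × ¬ P (suc M)
crossing-point P? P0 zero    ¬PN = ⊥-elim (¬PN P0)
crossing-point P? P0 (suc N) ¬PN with P? N
... | yes PN  = N , PN , ¬PN
... | no  ¬PN = crossing-point P? P0 N ¬PN

root-bracket : ∀ Q B X → 0 < B → ∃ λ M → M ^ suc Q * B ≤ X × X < suc M ^ suc Q * B
root-bracket Q B X 0<B =
  let M , M-low , ¬M-high = crossing-point (λ x → x ^ suc Q * B ≤? X) z≤n (suc X) (<⇒≱ X<)
  in  M , M-low , ≰⇒> ¬M-high
  where
  X< : X < suc X ^ suc Q * B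
  X< = ≤-trans (m≤m*n (suc X) (suc X ^ Q) {{m^n≢0 (suc X) Q}})
               (m≤m*n (suc X ^ suc Q) B {{ℕ.>-nonZero 0<B}})

-- With c = a/b, A = a^K and B = b^K, the hypotheses say e > 2c n^{1+1/K} and M = ⌊2c n^{1/K}⌋.
module Threshold (Q A B n e M : ℕ)
  (dense  : 2 ^ suc Q * (A * n) * n ^ suc Q < e ^ suc Q * B)
  (M-low  : M ^ suc Q * B ≤ 2 ^ suc Q * (A * n))
  (M-high : 2 ^ suc Q * (A * n) < suc M ^ suc Q * B) where

  K : ℕ
  K = suc Q

  M*n<e : M * n < e
  M*n<e = ≰⇒> λ e≤Mn → <⇒≱ dense (begin
    e ^ K * B                       ≤⟨ *-monoˡ-≤ B (^-monoˡ-≤ K e≤Mn) ⟩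
    (M * n) ^ K * B                 ≡⟨ cong (_* B) (^-distribʳ-* M n K) ⟩
    M ^ K * n ^ K * B               ≡⟨ swap (M ^ K) (n ^ K) B ⟩
    M ^ K * B * n ^ K               ≤⟨ *-monoˡ-≤ (n ^ K) M-low ⟩
    2 ^ K * (A * n) * n ^ K         ∎)
    where
    open ≤-Reasoning
    swap : ∀ a b c → a * b * c ≡ a * c * b
    swap = solve-∀

  -- The factor 2^K in M-high pays for halving M + 1.
  below-half : ∀ D → suc M ≤ 2 * D → A * n < D ^ K * B
  below-half D 1+M≤2D = *-cancelˡ-< (2 ^ K) (A * n) (D ^ K * B) (begin-strict
    2 ^ K * (A * n)                 <⟨ M-high ⟩
    suc M ^ K * B                   ≤⟨ *-monoˡ-≤ B (^-monoˡ-≤ K 1+M≤2D) ⟩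
    (2 * D) ^ K * B                 ≡⟨ cong (_* B) (^-distribʳ-* 2 D K) ⟩
    2 ^ K * D ^ K * B               ≡⟨ *-assoc (2 ^ K) (D ^ K) B ⟩
    2 ^ K * (D ^ K * B)             ∎)
    where open ≤-Reasoning

  -- When c^K n ≥ 1, the threshold M is at least c n^{1/K}.
  large-threshold : B ≤ A * n → A * n ≤ M ^ K * B
  large-threshold B≤An with M ℕ.≟ 0
  ... | yes M≡0 = ⊥-elim (<⇒≱ M-high (begin
    suc M ^ K * B      ≡⟨ cong (λ x → suc x ^ K * B) M≡0 ⟩
    1 ^ K * B          ≡⟨ cong (_* B) (^-zeroˡ K) ⟩
    1 * B              ≡⟨ *-identityˡ B ⟩
    B                  ≤⟨ B≤An ⟩
    A * n              ≤⟨ m≤n*m (A * n) (2 ^ K) {{m^n≢0 2 K}} ⟩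
    2 ^ K * (A * n)    ∎))
    where open ≤-Reasoning
  ... | no M≢0 = <⇒≤ (below-half M 1+M≤2M)
    where
    1+M≤2M : suc M ≤ 2 * M
    1+M≤2M = ≤-trans (≤-reflexive (+-comm 1 M))
               (+-monoʳ-≤ M (≤-trans (n≢0⇒n>0 M≢0) (≤-reflexive (≡.sym (+-identityʳ M)))))

  degree-cap : ∀ D → .{{ℕ.NonZero n}} → D ≤ n → D * M ^ Q ≤ n → D ^ K * A ^ Q ≤ n * B ^ Q
  degree-cap D D≤n DM^Q≤n = *-cancelʳ-≤ (D ^ K * A ^ Q) (n * B ^ Q) (n ^ Q) {{m^n≢0 n Q}} (begin
    D ^ K * A ^ Q * n ^ Q         ≡⟨ *-assoc (D ^ K) (A ^ Q) (n ^ Q) ⟩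
    D ^ K * (A ^ Q * n ^ Q)       ≡⟨ cong (D ^ K *_) (^-distribʳ-* A n Q) ⟨
    D ^ K * (A * n) ^ Q           ≤⟨ bounded (B ≤? A * n) ⟩
    n ^ K * B ^ Q                 ≡⟨ rotate n (n ^ Q) (B ^ Q) ⟩
    n * B ^ Q * n ^ Q             ∎)
    where
    open ≤-Reasoning
    rotate : ∀ a b c → a * b * c ≡ a * c * b
    rotate = solve-∀
    regroup : D ^ K * (M ^ K * B) ^ Q ≡ (D * M ^ Q) ^ K * B ^ Q
    regroup = begin-equality
      D ^ K * (M ^ K * B) ^ Q          ≡⟨ cong (D ^ K *_) (^-distribʳ-* (M ^ K) B Q) ⟩
      D ^ K * ((M ^ K) ^ Q * B ^ Q)    ≡⟨ cong (λ x → D ^ K * (x * B ^ Q)) (^-*-assoc M K Q) ⟩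
      D ^ K * (M ^ (K * Q) * B ^ Q)    ≡⟨ cong (λ x → D ^ K * (M ^ x * B ^ Q)) (*-comm K Q) ⟩
      D ^ K * (M ^ (Q * K) * B ^ Q)    ≡⟨ cong (λ x → D ^ K * (x * B ^ Q)) (^-*-assoc M Q K) ⟨
      D ^ K * ((M ^ Q) ^ K * B ^ Q)    ≡⟨ *-assoc (D ^ K) ((M ^ Q) ^ K) (B ^ Q) ⟨
      D ^ K * (M ^ Q) ^ K * B ^ Q      ≡⟨ cong (_* B ^ Q) (^-distribʳ-* D (M ^ Q) K) ⟨
      (D * M ^ Q) ^ K * B ^ Q          ∎
    bounded : Dec (B ≤ A * n) → D ^ K * (A * n) ^ Q ≤ n ^ K * B ^ Q
    bounded (yes B≤An) = begin
      D ^ K * (A * n) ^ Q              ≤⟨ *-monoʳ-≤ (D ^ K) (^-monoˡ-≤ Q (large-threshold B≤An)) ⟩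
      D ^ K * (M ^ K * B) ^ Q          ≡⟨ regroup ⟩
      (D * M ^ Q) ^ K * B ^ Q          ≤⟨ *-monoˡ-≤ (B ^ Q) (^-monoˡ-≤ K DM^Q≤n) ⟩
      n ^ K * B ^ Q                    ∎
    bounded (no B≰An) = *-mono-≤ (^-monoˡ-≤ K D≤n) (^-monoˡ-≤ Q (<⇒≤ (≰⇒> B≰An)))

  vertex-bound : ∀ N → 0 < N → suc M * M ^ Q ≤ N → A * n ≤ N * B
  vertex-bound N 0<N 1+M*M^Q≤N with B ≤? A * n
  ... | yes B≤An = begin
    A * n              ≤⟨ large-threshold B≤An ⟩
    M * M ^ Q * B      ≤⟨ *-monoˡ-≤ B (≤-trans (*-monoˡ-≤ (M ^ Q) (n≤1+n M)) 1+M*M^Q≤N) ⟩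
    N * B              ∎
    where open ≤-Reasoning
  ... | no B≰An = ≤-trans (<⇒≤ (≰⇒> B≰An)) (m≤n*m B N {{ℕ.>-nonZero 0<N}})

module BipartiteCore {n} (G : Graph n) (q M : ℕ) (girth : GirthGreaterThan G (2 * suc q)) where

  open Pruning G

  ThresholdBipartite : Set
  ThresholdBipartite = Σ (Subgraph G) λ G′ → Bipartite G′ ×
    (∀ v → T (inV G′ v) → suc M ≤ 2 * degree G′ v) ×
    (∀ v → T (inV G′ v) → degree G′ v * M ^ q ≤ vcount G′) ×
    (0 < vcount G′ × suc M * M ^ q ≤ vcount G′)

  module _ (R : Fin n → Bool) (R-deg : ∀ u → T (R u) → M < degreeIn R u) where

    open LocalMaxCut (induced R) (induced-sym R) (induced-irrefl R)

    induced⊆adj : ∀ x y → T (induced R x y) → T (adj G x y)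
    induced⊆adj x y = proj₁ ∘ T-induced R

    induced⊆R : ∀ x y → T (induced R x y) → T (R y)
    induced⊆R x y = proj₂ ∘ proj₂ ∘ T-induced R

    moore : ∀ v (F : Fin n → Bool) → (∀ y → T (F y) → T (induced R v y)) → count F * M ^ q ≤ count R
    moore v F F⊆ = MooreBound.moore-bound G (suc q) girth (induced R) R M induced⊆adj induced⊆R R-deg
                     v F (λ y → induced⊆adj v y ∘ F⊆ y) (λ y → induced⊆R v y ∘ F⊆ y) (s≤s z≤n)

    T-bichromatic : ∀ col {i j} → T (bichromatic col i j) → T (induced R i j) × T (col i xor col j)
    T-bichromatic col {i} {j} = Equivalence.to (T-∧ {induced R i j})

    crossing : (Fin n → Bool) → Subgraph G
    crossing col = record
      { inV   = R
      ; E     = bichromatic col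
      ; E-sym = bichromatic-sym col
      ; E⊆adj = λ i j → induced⊆adj i j ∘ proj₁ ∘ T-bichromatic col
      ; E⊆V   = λ i j → proj₁ ∘ proj₂ ∘ T-induced R ∘ proj₁ ∘ T-bichromatic col
      }

    crossing-bipartite : ∀ col → Bipartite (crossing col)
    crossing-bipartite col = col , λ i j t col-i≡col-j →
      subst T (trans (cong (col i xor_) (≡.sym col-i≡col-j)) (xor-same (col i))) (proj₂ (T-bichromatic col t))

    crossing-degree : ∀ col → (∀ u → count (monochromatic col u) ≤ count (bichromatic col u)) →
                      ∀ u → T (R u) → suc M ≤ 2 * degree (crossing col) u
    crossing-degree col locallyMax u Ru = begin
      suc M                                                  ≤⟨ R-deg u Ru ⟩
      count (induced R u)                                    ≡⟨ monochromatic+bichromatic col u ⟨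
      count (monochromatic col u) + count (bichromatic col u) ≤⟨ +-monoˡ-≤ _ (locallyMax u) ⟩
      count (bichromatic col u) + count (bichromatic col u)  ≡⟨ cong (count (bichromatic col u) +_) (+-identityʳ _) ⟨
      2 * count (bichromatic col u)                          ∎
      where open ≤-Reasoning

    bipartite-core : ∀ v → T (R v) → ThresholdBipartite
    bipartite-core v Rv =
      let col , locallyMax = localMaxCut _ (λ _ → true) ≤-refl
      in  crossing col , crossing-bipartite col , crossing-degree col locallyMax ,
          (λ u _ → moore u (bichromatic col u) (λ y → proj₁ ∘ T-bichromatic col)) ,
          subst (0 <_) (≡.sym (count-∖-∈ R v Rv)) (s≤s z≤n) ,
          ≤-trans (*-monoˡ-≤ (M ^ q) (R-deg v Rv)) (moore v (induced R v) (λ _ t → t))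

  dense⇒bipartite : M * n < edgeCount G → ThresholdBipartite
  dense⇒bipartite M*n<e =
    let R , R-deg , v , Rv = dense⇒core M M*n<e
    in  bipartite-core R R-deg v Rv

module Translation (q : ℕ) {c : ℚ} {a b : ℕ} (c≐ : IsRatio c a b) where

  K A B : ℕ
  K = suc q
  A = a ^ K
  B = b ^ K

  c^K≐ : IsRatio (c ^ℚ K) A B
  c^K≐ = ratio-^ c≐ K

  dense-ℕ : ∀ {n e} → (ℕ→ℚ 2 ^ℚ K) *ℚ (c ^ℚ K) *ℚ (ℕ→ℚ n ^ℚ (K + 1)) <ℚ ℕ→ℚ e ^ℚ K →
            2 ^ K * (A * n) * n ^ K < e ^ K * B
  dense-ℕ {n} {e} dense = subst₂ _<_ lhs rhs
    (ratio-< (ratio-* (ratio-* (ratio-ℕ^ 2 K) c^K≐) (ratio-ℕ^ n (K + 1))) (ratio-ℕ^ e K) dense)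
    where
    lhs : 2 ^ K * A * n ^ (K + 1) * 1 ≡ 2 ^ K * (A * n) * n ^ K
    lhs rewrite ^-distribˡ-+-* n K 1 = regroup (2 ^ K) A (n ^ K) n
      where
      regroup : ∀ t x p m → t * x * (p * (m * 1)) * 1 ≡ t * (x * m) * p
      regroup = solve-∀
    rhs : e ^ K * (1 * B * 1) ≡ e ^ K * B
    rhs = cong (e ^ K *_) (trans (*-identityʳ (1 * B)) (*-identityˡ B))

  min-degree-ℚ : ∀ n D → A * n < D ^ K * B → (c ^ℚ K) *ℚ ℕ→ℚ n ≤ℚ ℕ→ℚ D ^ℚ K
  min-degree-ℚ n D An<D^KB = ratio-≤ (ratio-* c^K≐ (ratio-ℕ n)) (ratio-ℕ^ D K)
    (subst₂ _≤_ (≡.sym (*-identityʳ (A * n))) (cong (D ^ K *_) (≡.sym (*-identityʳ B))) (<⇒≤ An<D^KB))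

  max-degree-ℚ : ∀ n D → D ^ K * A ^ q ≤ n * B ^ q → (ℕ→ℚ D ^ℚ K) *ℚ (c ^ℚ (K * q)) ≤ℚ ℕ→ℚ n
  max-degree-ℚ n D bound = ratio-≤ (ratio-* (ratio-ℕ^ D K) (ratio-^ c≐ (K * q))) (ratio-ℕ n)
    (subst₂ _≤_ (trans (cong (D ^ K *_) (^-*-assoc a K q)) (≡.sym (*-identityʳ _)))
                (cong (n *_) (trans (^-*-assoc b K q) (≡.sym (*-identityˡ _)))) bound)

  size-ℚ : ∀ n N → A * n ≤ N * B → (c ^ℚ K) *ℚ ℕ→ℚ n ≤ℚ ℕ→ℚ N
  size-ℚ n N An≤NB = ratio-≤ (ratio-* c^K≐ (ratio-ℕ n)) (ratio-ℕ N)
    (subst₂ _≤_ (≡.sym (*-identityʳ (A * n))) (cong (N *_) (≡.sym (*-identityʳ B))) An≤NB)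

lemma4 : (k : ℕ) → 3 ≤ k → (c : ℚ) → 0ℚ <ℚ c →
    (n : ℕ) → (G : Graph n) → GirthGreaterThan G (2 * k) →
    (ℕ→ℚ 2 ^ℚ k) *ℚ (c ^ℚ k) *ℚ (ℕ→ℚ n ^ℚ (k + 1)) <ℚ ℕ→ℚ (edgeCount G) ^ℚ k →
    Σ (Subgraph G) λ G′ →
      Bipartite G′ ×
      (∀ v → T (inV G′ v) → (c ^ℚ k) *ℚ ℕ→ℚ n ≤ℚ ℕ→ℚ (degree G′ v) ^ℚ k) ×
      (∀ v → T (inV G′ v) → (ℕ→ℚ (degree G′ v) ^ℚ k) *ℚ (c ^ℚ (k * (k ∸ 1))) ≤ℚ ℕ→ℚ n) ×
      ((c ^ℚ k) *ℚ ℕ→ℚ n ≤ℚ ℕ→ℚ (vcount G′))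
lemma4 (suc q) _ c 0<c n G girth dense with ratio-positive c 0<c
... | a , d , c≐ with root-bracket q (suc d ^ suc q) (2 ^ suc q * (a ^ suc q * n)) (m^n>0 (suc d) (suc q))
...   | M , M-low , M-high =
  let open Translation q c≐
      open Threshold q A B n (edgeCount G) M (dense-ℕ {n} {edgeCount G} dense) M-low M-high
      G′ , bipartite , deg-low , deg-high , nonempty , size = BipartiteCore.dense⇒bipartite G q M girth M*n<e
  in  G′ , bipartite ,
      (λ v v∈ → min-degree-ℚ n (degree G′ v) (below-half (degree G′ v) (deg-low v v∈))) ,
      (λ v v∈ → max-degree-ℚ n (degree G′ v) (degree-cap (degree G′ v) {{Finₚ.nonZeroIndex v}}
                  (count≤n _) (≤-trans (deg-high v v∈) (count≤n _)))) ,
      size-ℚ n (vcount G′) (vertex-bound (vcount G′) nonempty size)
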